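{- Let $\alpha,n\in\mathbb{Z}^+$ and $(A,B)\in\mathcal{T}(\alpha,[n])$, with $k_s=|s_1|$ and $k_r=|r_1|$. Then there exists a unique set \[M\subseteq\Big[0,\ \frac{n}{(k_r/k_s)+1}-1\Big]\] of integers such that \[A=\bigcup_{m\in M}\big([1,k_s]+\{m(k_s+k_r)\}\big).\]
   Context: $[n]=\{1,\dots,n\}$ and $[x,y]=\{x,x+1,\dots,y\}$. $A+B$ is the Minkowski sum. $\mathcal{T}(\alpha,C)$ is the set of pairs $(A,B)$ of finite subsets of $\mathbb{Z}$ with $A+B=C$, $|C|=|A||B|$, $|A|=\alpha$, $0\in B$, $\min B\ge0$. For $(A,B)\in\mathcal{T}(\alpha,[n])$ (so $1\in A\subseteq[n]$), the first segment $s_1$ is the maximal run of consecutive integers in $A$ starting at $1$, and the first rift $r_1$ is the set of integers strictly between $\max s_1$ and the next element of $A$ (i.e. $\min(A\setminus s_1)$); $r_1=\emptyset$ if $A=s_1$. -}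

module Defs where

open import Data.Nat using (ℕ; suc) renaming (_+_ to _+ℕ_; _*_ to _*ℕ_)
open import Data.Integer using (ℤ; +_; _+_; _-_; _*_; _≤_; _⊔_)
open import Data.List using (List; length; applyUpTo)
open import Data.List.Membership.Propositional using (_∈_; _∉_)
open import Data.List.Relation.Unary.All using (All)
open import Data.List.Relation.Unary.Unique.Propositional using (Unique)
open import Data.Product using (Σ; _×_; ∃)
open import Data.Sum using (_⊎_)
open import Relation.Nullary using (¬_)
open import Relation.Binary.PropositionalEquality using (_≡_)
open import Function.Bundles using (_⇔_)

-- Finite sets of integers are represented by duplicate-free lists
-- (cardinality = length, membership = _∈_).

InInterval : ℤ → ℤ → ℤ → Set
InInterval x y z = x ≤ z × z ≤ y

interval1 : ℕ → List ℤ
interval1 n = applyUpTo (λ i → + suc i) n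

SumsetEq : List ℤ → List ℤ → List ℤ → Set
SumsetEq A B C = ∀ c → c ∈ C ⇔ (Σ ℤ λ a → Σ ℤ λ b → a ∈ A × b ∈ B × a + b ≡ c)

InT : ℕ → List ℤ → List ℤ → List ℤ → Set
InT α C A B =
  Unique A × Unique B × SumsetEq A B C ×
  length C ≡ length A *ℕ length B ×
  length A ≡ α × (+ 0) ∈ B × All (λ b → + 0 ≤ b) B

InSeg : ℕ → ℤ → Set
InSeg ks x = InInterval (+ 1) (+ ks) x

FirstSegmentLength : List ℤ → ℕ → Set
FirstSegmentLength A ks = (∀ i → InSeg ks i → i ∈ A) × (+ suc ks) ∉ A

-- kr = |r₁|: either A = s₁ and kr = 0, or a₀ = min (A ∖ s₁) and
-- kr = #{x : ks < x < a₀} = max(a₀ - ks - 1, 0).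
FirstRiftLength : List ℤ → ℕ → ℕ → Set
FirstRiftLength A ks kr =
  (All (InSeg ks) A × kr ≡ 0)
  ⊎ (Σ ℤ λ a₀ → a₀ ∈ A × ¬ InSeg ks a₀ ×
       (∀ a → a ∈ A → ¬ InSeg ks a → a₀ ≤ a) ×
       + kr ≡ (a₀ - + suc ks) ⊔ + 0)

-- M ⊆ [0, n/((kr/ks)+1) - 1], i.e. for integer m:
-- 0 ≤ m and (m + 1)(ks + kr) ≤ n·ks.
InBound : ℕ → ℕ → ℕ → ℤ → Set
InBound n ks kr m = + 0 ≤ m × (m + + 1) * (+ (ks +ℕ kr)) ≤ + (n *ℕ ks)

UnionRep : ℕ → ℕ → List ℤ → List ℤ → Set
UnionRep ks kr A M =
  ∀ x → x ∈ A ⇔ (Σ ℤ λ m → Σ ℤ λ i → m ∈ M × InSeg ks i × x ≡ i + m * (+ (ks +ℕ kr)))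

GoodM : ℕ → ℕ → ℕ → List ℤ → List ℤ → Set
GoodM n ks kr A M = All (InBound n ks kr) M × UnionRep ks kr A M

SameSet : List ℤ → List ℤ → Set
SameSet M M' = ∀ x → x ∈ M ⇔ x ∈ M'

module Submission where

open import Defs
open import Data.Nat using (ℕ; _≤_)
open import Data.Integer using (ℤ)
open import Data.List using (List)
open import Data.List.Relation.Unary.Unique.Propositional using (Unique)
open import Data.Product using (Σ; _×_)

-- Shift A down by one, so that A ⊕ B = {0, …, n-1} with 0 ∈ A ∩ B, every sum having a
-- unique representation (a counting argument from |C| = |A||B|).
--
-- If [0, t) ⊆ A and t ∉ A, then every b ∈ B is a multiple of t and A is a union of whole
-- blocks [qt, qt + t).  This is proved for all sums a + b below qt by induction on q: a sum
-- inside the block of qt is obtained from the representation a′ + b′ of qt itself by adding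
-- the offset to a′, and when qt ∈ A the rest of its block is forced into A one element at a
-- time, every other representation of the next element colliding with a sum already known.
--
-- If A ⊈ [0, t), let d be the least element of A beyond [0, t).  Its block is full, so t ∣ d.  Dividing
-- the tiling by t and exchanging the roles of A and B gives a tiling in which [0, d/t)
-- lies in B/t and d/t does not; the same lemma then makes every q with qt ∈ A a multiple of d/t.
-- Hence A = ⋃ { [0, t) + md | md ∈ A }, and the multipliers m are determined by A.

module ListCounting where

  open import Data.Nat using (suc; _+_; _*_; s≤s; z≤n)
  open import Data.Nat.Properties using (≤-trans; ≤-reflexive; <⇒≱)
  open import Data.List using ([]; _∷_; _++_; _∷ʳ_; length; map; cartesianProductWith)
  open import Data.List.Properties using (length-++; length-map; length-removeAt′; ∷ʳ-++)
  open import Data.List.Membership.Propositional using (_∈_; _∉_)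
  open import Data.List.Membership.Propositional.Properties using (∈-map⁺; ∈-cartesianProductWith⁺)
  open import Data.List.Relation.Binary.Subset.Propositional using (_⊆_)
  open import Data.List.Relation.Unary.Any using (here; there; index; _─_)
  open import Data.List.Relation.Unary.All using (lookup)
  open import Data.List.Relation.Unary.All.Properties using (¬Any⇒All¬; ++⁻ʳ)
  open import Data.List.Relation.Unary.AllPairs using ([]; _∷_)
  open import Data.Empty using (⊥-elim)
  open import Relation.Binary.PropositionalEquality
    using (_≡_; _≢_; refl; sym; trans; cong; cong₂; subst)

  module _ {X : Set} where

    ∈-─⁺ : ∀ {x y : X} {ys} (p : x ∈ ys) → y ∈ ys → y ≢ x → y ∈ (ys ─ p)
    ∈-─⁺ (here refl) (here refl) y≢x = ⊥-elim (y≢x refl)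
    ∈-─⁺ (here refl) (there q)   _   = q
    ∈-─⁺ (there p)   (here refl) _   = here refl
    ∈-─⁺ (there p)   (there q)   y≢x = there (∈-─⁺ p q y≢x)

    Unique-⊆⇒length≤ : ∀ {xs ys : List X} → Unique xs → xs ⊆ ys → length xs ≤ length ys
    Unique-⊆⇒length≤ {[]}     _            _     = z≤n
    Unique-⊆⇒length≤ {x ∷ xs} {ys} (x∉xs ∷ xs!) xs⊆ys =
      ≤-trans (s≤s (Unique-⊆⇒length≤ xs! xs⊆ys─p)) (≤-reflexive (sym (length-removeAt′ ys (index p))))
      where
      p = xs⊆ys (here refl)
      xs⊆ys─p : xs ⊆ (ys ─ p)
      xs⊆ys─p q = ∈-─⁺ p (xs⊆ys (there q)) (λ y≡x → lookup x∉xs q (sym y≡x))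

    ++-∷-⊆ : ∀ {y : X} (P : List X) {ys} → y ∈ ys → P ++ y ∷ ys ⊆ P ++ ys
    ++-∷-⊆ []      y∈ys (here refl) = y∈ys
    ++-∷-⊆ []      y∈ys (there q)   = q
    ++-∷-⊆ (_ ∷ P) y∈ys (here refl) = here refl
    ++-∷-⊆ (_ ∷ P) y∈ys (there q)   = there (++-∷-⊆ P y∈ys q)

    length-++-∷ : ∀ (P : List X) {y ys} → length (P ++ y ∷ ys) ≡ suc (length (P ++ ys))
    length-++-∷ []      = refl
    length-++-∷ (_ ∷ P) = cong suc (length-++-∷ P)

    -- The prefix P holds the already inspected part of the covering list.
    Unique-cover : ∀ {xs : List X} (P ys : List X) → Unique xs → xs ⊆ P ++ ys →
                   length (P ++ ys) ≤ length xs → Unique ys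
    Unique-cover P []       _   _   _   = []
    Unique-cover {xs} P (y ∷ ys) xs! xs⊆ len =
      ¬Any⇒All¬ ys y∉ys ∷
      Unique-cover (P ∷ʳ y) ys xs! (subst (xs ⊆_) (sym (∷ʳ-++ P y ys)) xs⊆)
                                   (subst (λ zs → length zs ≤ length xs) (sym (∷ʳ-++ P y ys)) len)
      where
      y∉ys : y ∉ ys
      y∉ys y∈ys = <⇒≱ (subst (_≤ length xs) (length-++-∷ P) len)
                      (Unique-⊆⇒length≤ xs! (λ q → ++-∷-⊆ P y∈ys (xs⊆ q)))

    Unique-++⇒disjoint : ∀ (us : List X) {vs u} → Unique (us ++ vs) → u ∈ us → u ∉ vs
    Unique-++⇒disjoint (_ ∷ us) (u≢ ∷ _)  (here refl) u∈vs = lookup (++⁻ʳ us u≢) u∈vs refl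
    Unique-++⇒disjoint (_ ∷ us) (_ ∷ us!) (there p)   u∈vs = Unique-++⇒disjoint us us! p u∈vs

    Unique-++⁻ʳ : ∀ (us : List X) {vs} → Unique (us ++ vs) → Unique vs
    Unique-++⁻ʳ []       vs!       = vs!
    Unique-++⁻ʳ (_ ∷ us) (_ ∷ us!) = Unique-++⁻ʳ us us!

  module _ {X Y Z : Set} (f : X → Y → Z) where

    length-cartesianProductWith : ∀ xs ys → length (cartesianProductWith f xs ys) ≡ length xs * length ys
    length-cartesianProductWith []       ys = refl
    length-cartesianProductWith (x ∷ xs) ys = trans (length-++ (map (f x) ys))
      (cong₂ _+_ (length-map (f x) ys) (length-cartesianProductWith xs ys))

    Unique-cartesianProductWith⇒injectiveˡ :
      ∀ {xs ys x x′ y y′} → Unique (cartesianProductWith f xs ys) →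
      x ∈ xs → y ∈ ys → x′ ∈ xs → y′ ∈ ys → f x y ≡ f x′ y′ → x ≡ x′
    Unique-cartesianProductWith⇒injectiveˡ {_ ∷ xs} _ (here refl) _ (here refl) _ _ = refl
    Unique-cartesianProductWith⇒injectiveˡ {x ∷ xs} {ys} ! (here refl) y∈ (there x′∈) y′∈ eq =
      ⊥-elim (Unique-++⇒disjoint (map (f x) ys) ! (∈-map⁺ (f x) y∈)
               (subst (_∈ cartesianProductWith f xs ys) (sym eq) (∈-cartesianProductWith⁺ f x′∈ y′∈)))
    Unique-cartesianProductWith⇒injectiveˡ {x ∷ xs} {ys} ! (there x∈) y∈ (here refl) y′∈ eq =
      ⊥-elim (Unique-++⇒disjoint (map (f x) ys) ! (∈-map⁺ (f x) y′∈)
               (subst (_∈ cartesianProductWith f xs ys) eq (∈-cartesianProductWith⁺ f x∈ y∈)))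
    Unique-cartesianProductWith⇒injectiveˡ {x ∷ xs} {ys} ! (there x∈) y∈ (there x′∈) y′∈ eq =
      Unique-cartesianProductWith⇒injectiveˡ (Unique-++⁻ʳ (map (f x) ys) !) x∈ y∈ x′∈ y′∈ eq

module PrefixTilings where

  open import Data.Nat
    using (zero; suc; pred; _+_; _*_; _∸_; _<_; s≤s; s≤s⁻¹; z≤n; z<s; NonZero; >-nonZero; >-nonZero⁻¹)
  open import Data.Nat.Properties
  open import Data.Nat.DivMod
    using ( _/_; _%_; m/n*n≡m; m/n*n≤m; m≥n⇒m/n>0; 0/n≡0; m*n/n≡m; +-distrib-/-∣ˡ; m<n⇒m/n≡0
          ; m<n⇒m%n≡m; %-remove-+ˡ; %-remove-+ʳ; m≡m%n+[m/n]*n; m%n<n)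
  open import Data.Nat.Divisibility
    using (_∣_; divides; divides-refl; _∣0; ∣m+n∣m⇒∣n; n∣m*n; ∣n⇒∣m*n)
  open import Data.Nat.Tactic.RingSolver using (solve-∀)
  open import Algebra.Properties.CommutativeSemigroup +-commutativeSemigroup using (xy∙z≈xz∙y)
  open import Data.Product using (∃₂; _,_; proj₁; proj₂)
  open import Data.Sum using (inj₁; inj₂)
  open import Relation.Nullary using (¬_; contradiction)
  open import Relation.Binary.PropositionalEquality
    using (_≡_; refl; sym; trans; cong; cong₂; subst; module ≡-Reasoning)

  pred[n]<n : ∀ n .{{_ : NonZero n}} → pred n < n
  pred[n]<n (suc n) = n<1+n n

  quotient-unique : ∀ {d m m′ r} .{{_ : NonZero d}} → r < d → m * d ≡ m′ * d + r → m ≡ m′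
  quotient-unique {d} {m} {m′} {r} r<d eq = begin
    m                      ≡⟨ m*n/n≡m m d ⟨
    m * d / d              ≡⟨ cong (_/ d) eq ⟩
    (m′ * d + r) / d       ≡⟨ +-distrib-/-∣ˡ r (n∣m*n m′) ⟩
    m′ * d / d + r / d     ≡⟨ cong₂ _+_ (m*n/n≡m m′ d) (m<n⇒m/n≡0 r<d) ⟩
    m′ + 0                 ≡⟨ +-identityʳ m′ ⟩
    m′                     ∎
    where open ≡-Reasoning

  -- A ⊕ B is an initial segment of ℕ, without naming its length: the sums are closed
  -- downwards and each has a unique representation.
  record IsPrefixTiling (A B : ℕ → Set) : Set where
    field
      split   : ∀ {a b x} → A a → B b → x ≤ a + b → ∃₂ λ a′ b′ → A a′ × B b′ × a′ + b′ ≡ x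
      cancelˡ : ∀ {a b a′ b′} → A a → B b → A a′ → B b′ → a + b ≡ a′ + b′ → a ≡ a′

    cancelʳ : ∀ {a b a′ b′} → A a → B b → A a′ → B b′ → a + b ≡ a′ + b′ → b ≡ b′
    cancelʳ pa pb pa′ pb′ eq with refl ← cancelˡ pa pb pa′ pb′ eq = +-cancelˡ-≡ _ _ _ eq

  swap : ∀ {A B} → IsPrefixTiling A B → IsPrefixTiling B A
  swap {A} {B} T = record { split = split′ ; cancelˡ = cancelˡ′ }
    where
    open IsPrefixTiling T
    split′ : ∀ {b a x} → B b → A a → x ≤ b + a → ∃₂ λ b′ a′ → B b′ × A a′ × b′ + a′ ≡ x
    split′ {b} {a} {x} pb pa x≤ with a′ , b′ , pa′ , pb′ , eq ← split pa pb (subst (x ≤_) (+-comm b a) x≤) =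
      b′ , a′ , pb′ , pa′ , trans (+-comm b′ a′) eq
    cancelˡ′ : ∀ {b a b′ a′} → B b → A a → B b′ → A a′ → b + a ≡ b′ + a′ → b ≡ b′
    cancelˡ′ {b} {a} {b′} {a′} pb pa pb′ pa′ eq =
      cancelʳ pa pb pa′ pb′ (trans (+-comm a b) (trans eq (+-comm b′ a′)))

  scale : ∀ {A B} → IsPrefixTiling A B → (t : ℕ) .{{_ : NonZero t}} → (∀ {b} → B b → t ∣ b) →
          IsPrefixTiling (λ q → A (q * t)) (λ k → B (k * t))
  scale {A} {B} T t t∣B = record
    { split   = λ {q} {k} → split′ {q} {k}
    ; cancelˡ = λ {q} {k} {q′} {k′} → cancelˡ′ {q} {k} {q′} {k′}
    }
    where
    open IsPrefixTiling T
    split′ : ∀ {q k x} → A (q * t) → B (k * t) → x ≤ q + k →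
             ∃₂ λ q′ k′ → A (q′ * t) × B (k′ * t) × q′ + k′ ≡ x
    split′ {q} {k} {x} pa pb x≤
      with a′ , b′ , pa′ , pb′ , eq ← split pa pb (subst (x * t ≤_) (*-distribʳ-+ t q k) (*-monoˡ-≤ t x≤))
      with divides-refl k′ ← t∣B pb′
      with divides-refl q′ ← ∣m+n∣m⇒∣n (subst (t ∣_) (trans (sym eq) (+-comm a′ b′)) (n∣m*n x))
                                        (divides-refl k′) =
      q′ , k′ , pa′ , pb′ , *-cancelʳ-≡ (q′ + k′) x t (trans (*-distribʳ-+ t q′ k′) eq)
    cancelˡ′ : ∀ {q k q′ k′} → A (q * t) → B (k * t) → A (q′ * t) → B (k′ * t) →
               q + k ≡ q′ + k′ → q ≡ q′
    cancelˡ′ {q} {k} {q′} {k′} pa pb pa′ pb′ eq = *-cancelʳ-≡ q q′ t (cancelˡ pa pb pa′ pb′ (begin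
      q * t + k * t    ≡⟨ *-distribʳ-+ t q k ⟨
      (q + k) * t      ≡⟨ cong (_* t) eq ⟩
      (q′ + k′) * t    ≡⟨ *-distribʳ-+ t q′ k′ ⟩
      q′ * t + k′ * t  ∎))
      where open ≡-Reasoning

  record BlockStructure (A B : ℕ → Set) (t d : ℕ) : Set where
    field
      t≤d        : t ≤ d
      gap∈B      : B (d ∸ t)
      decompose  : ∀ {a} → A a → ∃₂ λ m r → r < t × A (m * d) × a ≡ m * d + r
      fill-block : ∀ {m r} → A (m * d) → r < t → A (m * d + r)

    period-bound : ∀ {n} .{{_ : NonZero t}} → (∀ {a b} → A a → B b → a + b < n) →
                   ∀ {m} → A (m * d) → suc m * d ≤ n
    period-bound {n} inside {m} p = subst (_≤ n) last+1≡ (inside (fill-block {m} p (pred[n]<n t)) gap∈B)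
      where
      last+1≡ : suc (m * d + pred t + (d ∸ t)) ≡ suc m * d
      last+1≡ = begin
        suc (m * d + pred t + (d ∸ t))  ≡⟨ cong (_+ (d ∸ t)) (+-suc (m * d) (pred t)) ⟨
        m * d + suc (pred t) + (d ∸ t)  ≡⟨ cong (λ s → m * d + s + (d ∸ t)) (suc-pred t) ⟩
        m * d + t + (d ∸ t)             ≡⟨ +-assoc (m * d) t (d ∸ t) ⟩
        m * d + (t + (d ∸ t))           ≡⟨ cong (m * d +_) (m+[n∸m]≡n t≤d) ⟩
        m * d + d                       ≡⟨ +-comm (m * d) d ⟩
        suc m * d                       ∎
        where open ≡-Reasoning

  module Segment {A B : ℕ → Set} (T : IsPrefixTiling A B) (t : ℕ) .{{_ : NonZero t}}
                 (segment : ∀ {i} → i < t → A i) (t∉A : ¬ A t) (0∈B : B 0) where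
    open IsPrefixTiling T

    0∈A : A 0
    0∈A = segment (>-nonZero⁻¹ t)

    A∩B≡0 : ∀ {x} → A x → B x → x ≡ 0
    A∩B≡0 {x} pa pb = cancelˡ pa 0∈B 0∈A pb (+-identityʳ x)

    B-nonzero⇒t≤ : ∀ {b} → B b → 0 < b → t ≤ b
    B-nonzero⇒t≤ {b} pb 0<b with <-≤-connex b t
    ... | inj₂ t≤b = t≤b
    ... | inj₁ b<t = contradiction (A∩B≡0 (segment b<t) pb) (>⇒≢ 0<b)

    t∈B : ∀ {a b} → A a → B b → t ≤ a + b → B t
    t∈B pa pb t≤ with split pa pb t≤
    ... | a′ , zero   , pa′ , _   , eq = contradiction (subst A (trans (sym (+-identityʳ a′)) eq) pa′) t∉A
    ... | a′ , suc b″ , _   , pb′ , eq =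
      subst B (≤-antisym (subst (suc b″ ≤_) eq (m≤n+m (suc b″) a′)) (B-nonzero⇒t≤ pb′ z<s)) pb′

    FullBlock : ℕ → Set
    FullBlock q = ∀ {i} → i < t → A (q * t + i)

    Aligned : ℕ → ℕ → Set
    Aligned a b = t ∣ b × FullBlock (a / t)

    AlignedBelow : ℕ → Set
    AlignedBelow y = ∀ {a b} → A a → B b → a + b < y → Aligned a b

    AlignedAt : ℕ → Set
    AlignedAt y = ∀ {a b} → A a → B b → a + b ≡ y → Aligned a b

    block-filled : ∀ {q} → AlignedBelow (q * t) → t ≤ q * t → A (q * t) → FullBlock q
    block-filled {q} below t≤c c∈A {i} i<t = filled i i<t ≤-refl
      where
      c = q * t

      t∈B′ : B t
      t∈B′ = t∈B c∈A 0∈B (subst (t ≤_) (sym (+-identityʳ c)) t≤c)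

      module _ (s : ℕ) (s<t : suc s < t) (prev : ∀ {j} → j ≤ s → A (c + j)) where

        c+s∈A : A (c + s)
        c+s∈A = prev ≤-refl

        -- Otherwise (c + s) + t and (t - 1) + (c + s + 1) would coincide.
        not-at-top : ¬ B (c + suc s)
        not-at-top pb =
          <-irrefl refl (≤-<-trans (subst (t ≤_) c+s≡pred-t (≤-trans t≤c (m≤m+n c s))) (pred[n]<n t))
          where
          rearrange : ∀ c s p → (c + s) + suc p ≡ p + (c + suc s)
          rearrange = solve-∀
          c+s≡pred-t : c + s ≡ pred t
          c+s≡pred-t = cancelˡ c+s∈A t∈B′ (segment (pred[n]<n t)) pb
                         (trans (cong ((c + s) +_) (sym (suc-pred t))) (rearrange c s (pred t)))

        not-above-start : ∀ {a′ b′} → A (suc a′) → B b′ → suc a′ + b′ ≡ c + suc s → ¬ c ≤ b′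
        not-above-start {a′} {b′} _ pb′ eq c≤b′ =
          <⇒≢ (<-≤-trans (>-nonZero⁻¹ t) t≤c)
              (sym (m+n≡0⇒m≡0 c (A∩B≡0 (prev j≤s) (subst B (sym c+j≡b′) pb′))))
          where
          j = b′ ∸ c
          c+j≡b′ : c + j ≡ b′
          c+j≡b′ = m+[n∸m]≡n c≤b′
          j≤s : j ≤ s
          j≤s = s≤s⁻¹ (+-cancelˡ-< c j (suc s)
                  (subst (_< c + suc s) (sym c+j≡b′) (subst (b′ <_) eq (m<n+m b′ z<s))))

        -- Otherwise b′ is a multiple of t and a′ sits at offset s + 1 of a full block,
        -- so (a′ - 1) + b′ would coincide with (c + s) + 0.
        not-below-start : ∀ {a′ b′} → A a′ → B b′ → 0 < b′ → a′ + b′ ≡ c + suc s → ¬ b′ < c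
        not-below-start {a′} {b′} pa′ pb′ 0<b′ eq b′<c = <⇒≢ 0<b′ (sym (cancelʳ Q+s∈A pb′ c+s∈A 0∈B collide))
          where
          t∣b′ : t ∣ b′
          t∣b′ = proj₁ (below 0∈A pb′ b′<c)
          a′<c : a′ < c
          a′<c = +-cancelʳ-< b′ a′ c
                   (subst (_< c + b′) (sym eq) (+-monoʳ-< c (<-≤-trans s<t (B-nonzero⇒t≤ pb′ 0<b′))))
          Q = a′ / t * t
          a′%t≡ : a′ % t ≡ suc s
          a′%t≡ = begin
            a′ % t            ≡⟨ %-remove-+ʳ a′ t∣b′ ⟨
            (a′ + b′) % t     ≡⟨ cong (_% t) eq ⟩
            (c + suc s) % t   ≡⟨ %-remove-+ˡ (suc s) (n∣m*n q) ⟩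
            suc s % t         ≡⟨ m<n⇒m%n≡m s<t ⟩
            suc s             ∎
            where open ≡-Reasoning
          Q+s∈A : A (Q + s)
          Q+s∈A = proj₂ (below pa′ 0∈B (subst (_< c) (sym (+-identityʳ a′)) a′<c)) (<-trans (n<1+n s) s<t)
          rearrange : ∀ Q s b → suc (Q + s + b) ≡ (suc s + Q) + b
          rearrange = solve-∀
          collide : (Q + s) + b′ ≡ (c + s) + 0
          collide = suc-injective (begin
            suc (Q + s + b′)      ≡⟨ rearrange Q s b′ ⟩
            (suc s + Q) + b′      ≡⟨ cong (λ r → (r + Q) + b′) a′%t≡ ⟨
            (a′ % t + Q) + b′     ≡⟨ cong (_+ b′) (m≡m%n+[m/n]*n a′ t) ⟨
            a′ + b′               ≡⟨ eq ⟩
            c + suc s             ≡⟨ +-suc c s ⟩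
            suc (c + s)           ≡⟨ cong suc (+-identityʳ (c + s)) ⟨
            suc (c + s + 0)       ∎)
            where open ≡-Reasoning

        next : A (c + suc s)
        next with split c∈A t∈B′ (+-monoʳ-≤ c (<⇒≤ s<t))
        ... | zero   , b′     , _   , pb′ , eq = contradiction (subst B eq pb′) not-at-top
        ... | suc a″ , zero   , pa′ , _   , eq = subst A (trans (sym (+-identityʳ _)) eq) pa′
        ... | suc a″ , suc b″ , pa′ , pb′ , eq with <-≤-connex (suc b″) c
        ...   | inj₁ b′<c = contradiction b′<c (not-below-start pa′ pb′ z<s eq)
        ...   | inj₂ c≤b′ = contradiction c≤b′ (not-above-start pa′ pb′ eq)

      filled : ∀ r → r < t → ∀ {j} → j ≤ r → A (c + j)
      filled zero    _   z≤n = subst A (sym (+-identityʳ c)) c∈A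
      filled (suc r) r<t j≤ with m≤n⇒m<n∨m≡n j≤
      ... | inj₁ (s≤s j≤r) = filled r (<-trans (n<1+n r) r<t) j≤r
      ... | inj₂ refl      = next r r<t (filled r (<-trans (n<1+n r) r<t))

    aligned-at : ∀ q → AlignedBelow (q * t) → AlignedAt (q * t)
    aligned-at q       below {zero}         _  _  eq = divides q eq , subst FullBlock (sym (0/n≡0 t)) segment
    aligned-at zero    below {suc a} {zero} _  _  ()
    aligned-at (suc q) below {suc a} {zero} pa _  eq =
      t ∣0 , subst FullBlock (sym (trans (cong (_/ t) a≡c) (m*n/n≡m (suc q) t)))
                   (block-filled {suc q} below (m≤m+n t (q * t)) (subst A a≡c pa))
      where
      a≡c : suc a ≡ suc q * t
      a≡c = trans (sym (+-identityʳ (suc a))) eq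
    aligned-at q       below {suc a} {suc b} pa pb eq =
      proj₁ (below 0∈A pb (subst (suc b <_) eq (m<n+m (suc b) z<s))) ,
      proj₂ (below pa 0∈B (subst (suc a + 0 <_) eq (+-monoʳ-< (suc a) z<s)))

    aligned-in-block : ∀ q → AlignedAt (q * t) →
                       ∀ {a b} → A a → B b → q * t ≤ a + b → a + b < q * t + t → Aligned a b
    aligned-in-block q at {a} {b} pa pb lo hi
      with a′ , b′ , pa′ , pb′ , eq ← split pa pb lo
      with t∣b′ , block′ ← at pa′ pb′ eq =
      subst (t ∣_) (cancelʳ a′+r∈A pb′ pa pb sum≡) t∣b′ , subst FullBlock a′/t≡a/t block′
      where
      r = a + b ∸ q * t
      c+r≡a+b : q * t + r ≡ a + b
      c+r≡a+b = m+[n∸m]≡n lo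
      r<t : r < t
      r<t = +-cancelˡ-< (q * t) r t (subst (_< q * t + t) (sym c+r≡a+b) hi)
      t∣a′ : t ∣ a′
      t∣a′ = ∣m+n∣m⇒∣n (subst (t ∣_) (trans (sym eq) (+-comm a′ b′)) (n∣m*n q)) t∣b′
      a′+r∈A : A (a′ + r)
      a′+r∈A = subst (λ z → A (z + r)) (m/n*n≡m t∣a′) (block′ r<t)
      sum≡ : (a′ + r) + b′ ≡ a + b
      sum≡ = trans (xy∙z≈xz∙y a′ r b′) (trans (cong (_+ r) eq) c+r≡a+b)
      a′/t≡a/t : a′ / t ≡ a / t
      a′/t≡a/t = begin
        a′ / t            ≡⟨ +-identityʳ (a′ / t) ⟨
        a′ / t + 0        ≡⟨ cong (a′ / t +_) (m<n⇒m/n≡0 r<t) ⟨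
        a′ / t + r / t    ≡⟨ +-distrib-/-∣ˡ r t∣a′ ⟨
        (a′ + r) / t      ≡⟨ cong (_/ t) (cancelˡ a′+r∈A pb′ pa pb sum≡) ⟩
        a / t             ∎
        where open ≡-Reasoning

    aligned-below : ∀ q → AlignedBelow (q * t)
    aligned-below zero    _  _  ()
    aligned-below (suc q) {a} {b} pa pb a+b< with <-≤-connex (a + b) (q * t)
    ... | inj₁ a+b<c = aligned-below q pa pb a+b<c
    ... | inj₂ c≤a+b = aligned-in-block q (aligned-at q (aligned-below q)) pa pb c≤a+b
                         (subst (a + b <_) (+-comm t (q * t)) a+b<)

    B-multiple : ∀ {b} → B b → t ∣ b
    B-multiple {b} pb = proj₁ (aligned-below (suc b) 0∈A pb (m≤m*n (suc b) t))

    A-block : ∀ {a} → A a → FullBlock (a / t)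
    A-block {a} pa =
      proj₂ (aligned-below (suc a) pa 0∈B (subst (_< suc a * t) (sym (+-identityʳ a)) (m≤m*n (suc a) t)))

    A-block-start : ∀ {a} → A a → A (a / t * t)
    A-block-start {a} pa = subst A (+-identityʳ (a / t * t)) (A-block pa (>-nonZero⁻¹ t))

    A-block-of-multiple : ∀ {c i} → t ∣ c → A c → i < t → A (c + i)
    A-block-of-multiple {c} {i} t∣c pc i<t = subst (λ z → A (z + i)) (m/n*n≡m t∣c) (A-block pc i<t)

    no-rift : (∀ {a} → A a → a < t) → BlockStructure A B t t
    no-rift small = record
      { t≤d        = ≤-refl
      ; gap∈B      = subst B (sym (n∸n≡0 t)) 0∈B
      ; decompose  = λ {a} pa → 0 , a , small pa , 0∈A , refl
      ; fill-block = λ {m} → A-block-of-multiple (n∣m*n m)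
      }

  module FirstRift {A B : ℕ → Set} (T : IsPrefixTiling A B) (t : ℕ) .{{_ : NonZero t}}
                   (segment : ∀ {i} → i < t → A i) (t∉A : ¬ A t) (0∈B : B 0)
                   {d} (d∈A : A d) (t≤d : t ≤ d) (least : ∀ {a} → A a → t ≤ a → d ≤ a) where
    open Segment T t segment t∉A 0∈B

    u : ℕ
    u = d / t

    instance
      u≢0 : NonZero u
      u≢0 = >-nonZero (m≥n⇒m/n>0 t≤d)

    t∣d : t ∣ d
    t∣d = divides u (≤-antisym (least (A-block-start d∈A) (m≤n*m t u)) (m/n*n≤m d t))

    d≡ut : d ≡ u * t
    d≡ut = _∣_.equality t∣d

    scaled : IsPrefixTiling (λ q → A (q * t)) (λ k → B (k * t))
    scaled = scale T t B-multiple

    B-segment : ∀ {j} → j < u → B (j * t)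
    B-segment {j} j<u
      with IsPrefixTiling.split scaled {u} {0} (subst A d≡ut d∈A) 0∈B (≤-trans (<⇒≤ j<u) (m≤m+n u 0))
    ... | zero   , k , _  , pb , refl = pb
    ... | suc q′ , k , pa , _  , q+k≡j =
      contradiction (≤-<-trans u≤q (≤-<-trans (m≤m+n (suc q′) k) (subst (_< u) (sym q+k≡j) j<u)))
                    (<-irrefl refl)
      where
      u≤q : u ≤ suc q′
      u≤q = *-cancelʳ-≤ u (suc q′) t (subst (_≤ suc q′ * t) d≡ut (least pa (m≤m+n t (q′ * t))))

    u∉B : ¬ B (u * t)
    u∉B pb = <⇒≢ (<-≤-trans (>-nonZero⁻¹ t) t≤d) (sym (A∩B≡0 d∈A (subst B (sym d≡ut) pb)))

    module Quotient = Segment (swap scaled) u B-segment u∉B 0∈A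

    structure : BlockStructure A B t d
    structure = record
      { t≤d        = t≤d
      ; gap∈B      = subst B gap≡ (B-segment (pred[n]<n u))
      ; decompose  = decompose
      ; fill-block = λ {m} → A-block-of-multiple (∣n⇒∣m*n m t∣d)
      }
      where
      gap≡ : pred u * t ≡ d ∸ t
      gap≡ = begin
        pred u * t            ≡⟨ m+n∸m≡n t (pred u * t) ⟨
        suc (pred u) * t ∸ t  ≡⟨ cong (λ v → v * t ∸ t) (suc-pred u) ⟩
        u * t ∸ t             ≡⟨ cong (_∸ t) d≡ut ⟨
        d ∸ t                 ∎
        where open ≡-Reasoning
      decompose : ∀ {a} → A a → ∃₂ λ m r → r < t × A (m * d) × a ≡ m * d + r
      decompose {a} pa with divides m a/t≡mu ← Quotient.B-multiple {a / t} (A-block-start pa) =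
        m , a % t , m%n<n a t , subst A a/t*t≡md (A-block-start pa) ,
        trans (m≡m%n+[m/n]*n a t) (trans (cong (a % t +_) a/t*t≡md) (+-comm (a % t) (m * d)))
        where
        a/t*t≡md : a / t * t ≡ m * d
        a/t*t≡md = trans (cong (_* t) a/t≡mu) (trans (*-assoc m u t) (cong (m *_) (sym d≡ut)))

open ListCounting
open PrefixTilings

open import Data.Nat using (zero; suc; _<_; s≤s; z≤n; NonZero; >-nonZero; >-nonZero⁻¹)
  renaming (_+_ to _+ℕ_; _*_ to _*ℕ_; _∸_ to _∸ℕ_)
import Data.Nat.Properties as ℕ
open import Data.Integer using (+_; -[1+_]; _+_; _-_; _*_; _⊔_; _⊖_; +≤+) renaming (_≤_ to _≤ℤ_)
import Data.Integer as ℤ using (_≟_)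
import Data.Integer.Properties as ℤ
open import Data.List using ([]; length; cartesianProductWith; map; filter; upTo)
open import Data.List.Membership.Propositional using (_∈_; _∉_)
open import Data.List.Membership.DecPropositional ℤ._≟_ using (_∈?_)
open import Data.List.Membership.Propositional.Properties
  using (∈-applyUpTo⁺; ∈-applyUpTo⁻; ∈-cartesianProductWith⁺; ∈-map∘filter⁺; ∈-map∘filter⁻; ∈-upTo⁺)
open import Data.List.Relation.Unary.All using (All; lookup; tabulate)
import Data.List.Relation.Unary.Unique.Propositional.Properties as Unique
open import Data.Product using (∃₂; _,_)
open import Data.Sum using (inj₁; inj₂)
open import Relation.Nullary using (Dec; contradiction)
open import Function.Bundles using (_⇔_; mk⇔; Equivalence)
open import Function.Construct.Composition using (_⇔-∘_)
open import Function.Construct.Symmetry using (⇔-sym)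
open import Relation.Binary.PropositionalEquality using (_≡_; refl; sym; trans; cong; subst; module ≡-Reasoning)

module Interval (n : ℕ) {A B : List ℤ} (A+B≡[n] : SumsetEq A B (interval1 n))
                (|[n]|≡ : length (interval1 n) ≡ length A *ℕ length B)
                (0∈B : + 0 ∈ B) (B≥0 : All (+ 0 ≤ℤ_) B) where

  open Equivalence

  Aℕ Bℕ : ℕ → Set
  Aℕ x = + suc x ∈ A
  Bℕ x = + x ∈ B

  ∈[n]⁺ : ∀ {i} → i < n → + suc i ∈ interval1 n
  ∈[n]⁺ = ∈-applyUpTo⁺ (λ i → + suc i)

  ∈[n]⁻ : ∀ {c} → c ∈ interval1 n → ∃₂ λ i _ → c ≡ + suc i
  ∈[n]⁻ = ∈-applyUpTo⁻ (λ i → + suc i)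

  A-positive : ∀ {a} → a ∈ A → Σ ℕ λ j → a ≡ + suc j
  A-positive {a} a∈A with i , _ , a+0≡ ← ∈[n]⁻ (from (A+B≡[n] (a + + 0)) (a , + 0 , a∈A , 0∈B , refl)) =
    i , trans (sym (ℤ.+-identityʳ a)) a+0≡

  B-natural : ∀ {b} → b ∈ B → Σ ℕ λ k → b ≡ + k
  B-natural {+ k}       _   = k , refl
  B-natural { -[1+ k ]} b∈B with () ← lookup B≥0 b∈B

  sum-in-range : ∀ {a b} → Aℕ a → Bℕ b → a +ℕ b < n
  sum-in-range pa pb with i , i<n , eq ← ∈[n]⁻ (from (A+B≡[n] _) (_ , _ , pa , pb , refl)) =
    subst (_< n) (sym (ℕ.suc-injective (ℤ.+-injective eq))) i<n

  sums-unique : Unique (cartesianProductWith _+_ A B)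
  sums-unique = Unique-cover [] _ [n]-unique [n]⊆sums
                  (ℕ.≤-reflexive (trans (length-cartesianProductWith _+_ A B) (sym |[n]|≡)))
    where
    [n]-unique : Unique (interval1 n)
    [n]-unique = Unique.applyUpTo⁺₁ _ n (λ i<j _ eq → ℕ.<⇒≢ i<j (ℕ.suc-injective (ℤ.+-injective eq)))
    [n]⊆sums : ∀ {c} → c ∈ interval1 n → c ∈ cartesianProductWith _+_ A B
    [n]⊆sums {c} c∈ with a , b , a∈ , b∈ , refl ← to (A+B≡[n] c) c∈ = ∈-cartesianProductWith⁺ _+_ a∈ b∈

  tiling : IsPrefixTiling Aℕ Bℕ
  tiling = record { split = split ; cancelˡ = cancelˡ }
    where
    split : ∀ {a b x} → Aℕ a → Bℕ b → x ≤ a +ℕ b → ∃₂ λ a′ b′ → Aℕ a′ × Bℕ b′ × a′ +ℕ b′ ≡ x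
    split {x = x} pa pb x≤ with to (A+B≡[n] (+ suc x)) (∈[n]⁺ (ℕ.≤-<-trans x≤ (sum-in-range pa pb)))
    ... | a , b , a∈ , b∈ , eq with A-positive a∈ | B-natural b∈
    ...   | j , refl | k , refl = j , k , a∈ , b∈ , ℕ.suc-injective (ℤ.+-injective eq)
    cancelˡ : ∀ {a b a′ b′} → Aℕ a → Bℕ b → Aℕ a′ → Bℕ b′ → a +ℕ b ≡ a′ +ℕ b′ → a ≡ a′
    cancelˡ pa pb pa′ pb′ eq = ℕ.suc-injective (ℤ.+-injective
      (Unique-cartesianProductWith⇒injectiveˡ _+_ sums-unique pa pb pa′ pb′ (cong (λ s → + suc s) eq)))

  0∈Aℕ : 1 ≤ n → Aℕ 0
  0∈Aℕ 1≤n with to (A+B≡[n] (+ 1)) (∈[n]⁺ 1≤n)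
  ... | a , b , a∈ , b∈ , eq with A-positive a∈ | B-natural b∈
  ...   | zero  , refl | k , refl = a∈
  ...   | suc j , refl | k , refl with () ← ℤ.+-injective eq

  segment : ∀ t′ → (∀ i → InSeg (suc t′) i → i ∈ A) → ∀ {i} → i < suc t′ → Aℕ i
  segment t′ seg i<t = seg _ (+≤+ (s≤s z≤n) , +≤+ i<t)

  block-structure : ∀ t′ kr → (∀ i → InSeg (suc t′) i → i ∈ A) → + suc (suc t′) ∉ A →
                    FirstRiftLength A (suc t′) kr → BlockStructure Aℕ Bℕ (suc t′) (suc t′ +ℕ kr)
  block-structure t′ kr seg t∉A (inj₁ (A⊆seg , refl)) =
    subst (BlockStructure Aℕ Bℕ (suc t′)) (sym (ℕ.+-identityʳ (suc t′)))
          (Segment.no-rift tiling (suc t′) (segment t′ seg) t∉A 0∈B small)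
    where
    small : ∀ {a} → Aℕ a → a < suc t′
    small pa with _ , +≤+ a<t ← lookup A⊆seg pa = a<t
  block-structure t′ kr seg t∉A (inj₂ (a₀ , a₀∈A , a₀∉seg , a₀-least , kr≡)) with A-positive a₀∈A
  ... | d₀ , refl = subst (BlockStructure Aℕ Bℕ t) d₀≡t+kr
                      (FirstRift.structure tiling t (segment t′ seg) t∉A 0∈B a₀∈A t≤d₀ least)
    where
    t = suc t′
    t≤d₀ : t ≤ d₀
    t≤d₀ = ℕ.≮⇒≥ λ d₀<t → a₀∉seg (+≤+ (s≤s z≤n) , +≤+ d₀<t)
    least : ∀ {a} → Aℕ a → t ≤ a → d₀ ≤ a
    least {a} pa t≤a with +≤+ (s≤s d₀≤a) ← a₀-least _ pa (λ { (_ , +≤+ a<t) → ℕ.<⇒≱ a<t t≤a }) = d₀≤a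
    kr≡d₀-t : + kr ≡ + (d₀ ∸ℕ t)
    kr≡d₀-t = begin
      + kr                               ≡⟨ kr≡ ⟩
      (+ suc d₀ - + suc t) ⊔ + 0         ≡⟨ cong (_⊔ + 0) (ℤ.[+m]-[+n]≡m⊖n (suc d₀) (suc t)) ⟩
      (suc d₀ ⊖ suc t) ⊔ + 0             ≡⟨ cong (_⊔ + 0) (ℤ.⊖-≥ (s≤s t≤d₀)) ⟩
      + (d₀ ∸ℕ t) ⊔ + 0                  ≡⟨ ℤ.i≥j⇒i⊔j≡i (+≤+ z≤n) ⟩
      + (d₀ ∸ℕ t)                        ∎
      where open ≡-Reasoning
    d₀≡t+kr : d₀ ≡ t +ℕ kr
    d₀≡t+kr = trans (sym (ℕ.m+[n∸m]≡n t≤d₀)) (cong (t +ℕ_) (sym (ℤ.+-injective kr≡d₀-t)))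

  module Multipliers (ks kr : ℕ) .{{_ : NonZero ks}} (S : BlockStructure Aℕ Bℕ ks (ks +ℕ kr)) where
    open BlockStructure S

    d : ℕ
    d = ks +ℕ kr

    instance
      d≢0 : NonZero d
      d≢0 = >-nonZero (ℕ.<-≤-trans (>-nonZero⁻¹ ks) (ℕ.m≤m+n ks kr))

    Multiplier : ℤ → Set
    Multiplier z = Σ ℕ λ m → z ≡ + m × Aℕ (m *ℕ d)

    period-start? : ∀ m → Dec (Aℕ (m *ℕ d))
    period-start? m = + suc (m *ℕ d) ∈? A

    M : List ℤ
    M = map +_ (filter period-start? (upTo n))

    M-unique : Unique M
    M-unique = Unique.map⁺ ℤ.+-injective (Unique.filter⁺ period-start? (Unique.upTo⁺ n))

    ∈M⇔ : ∀ z → z ∈ M ⇔ Multiplier z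
    ∈M⇔ z = mk⇔ to′ from′
      where
      to′ : z ∈ M → Multiplier z
      to′ z∈M with m , _ , z≡ , pm ← ∈-map∘filter⁻ +_ period-start? {xs = upTo n} z∈M = m , z≡ , pm
      from′ : Multiplier z → z ∈ M
      from′ (m , z≡ , pm) = ∈-map∘filter⁺ +_ period-start? (m , ∈-upTo⁺ m<n , z≡ , pm)
        where
        m<n : m < n
        m<n = ℕ.≤-trans (ℕ.m≤m*n (suc m) d) (period-bound sum-in-range {m} pm)

    shift : ∀ m r → + suc (m *ℕ d +ℕ r) ≡ + suc r + + m * + d
    shift m r = trans (cong (λ x → + suc x) (ℕ.+-comm (m *ℕ d) r)) (cong (_+_ (+ suc r)) (ℤ.pos-* m d))

    natural : ∀ {z} → InBound n ks kr z → Σ ℕ λ m → z ≡ + m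
    natural {+ m}       _        = m , refl
    natural { -[1+ _ ]} (() , _)

    positive : ∀ {i} → InSeg ks i → Σ ℕ λ r → i ≡ + suc r × r < ks
    positive {+ zero}    (+≤+ () , _)
    positive {+ suc r}   (_ , +≤+ r<ks) = r , refl , r<ks
    positive { -[1+ _ ]} (() , _)

    in-bound : ∀ {z} → Multiplier z → InBound n ks kr z
    in-bound (m , refl , pm) = +≤+ z≤n , subst (_≤ℤ + (n *ℕ ks)) (ℤ.pos-* (m +ℕ 1) d) (+≤+ (begin
      (m +ℕ 1) *ℕ d  ≡⟨ cong (_*ℕ d) (ℕ.+-comm m 1) ⟩
      suc m *ℕ d     ≤⟨ period-bound sum-in-range {m} pm ⟩
      n              ≤⟨ ℕ.m≤m*n n ks ⟩
      n *ℕ ks        ∎))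
      where open ℕ.≤-Reasoning

    union : UnionRep ks kr A M
    union x = mk⇔ to′ from′
      where
      to′ : x ∈ A → Σ ℤ λ z → Σ ℤ λ i → z ∈ M × InSeg ks i × x ≡ i + z * + d
      to′ x∈A with A-positive x∈A
      ... | a , refl with m , r , r<ks , pm , a≡ ← decompose x∈A =
        + m , + suc r , from (∈M⇔ _) (m , refl , pm) , (+≤+ (s≤s z≤n) , +≤+ r<ks) ,
        trans (cong (λ y → + suc y) a≡) (shift m r)
      from′ : (Σ ℤ λ z → Σ ℤ λ i → z ∈ M × InSeg ks i × x ≡ i + z * + d) → x ∈ A
      from′ (z , i , z∈M , i∈seg , refl) with to (∈M⇔ z) z∈M | positive i∈seg
      ... | m , refl , pm | r , refl , r<ks = subst (_∈ A) (shift m r) (fill-block {m} pm r<ks)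

    M-good : GoodM n ks kr A M
    M-good = tabulate (λ {z} z∈M → in-bound (to (∈M⇔ z) z∈M)) , union

    good⇒∈⇔ : ∀ {M′} → GoodM n ks kr A M′ → ∀ z → z ∈ M′ ⇔ Multiplier z
    good⇒∈⇔ {M′} (bounds , rep) z = mk⇔ to′ from′
      where
      to′ : z ∈ M′ → Multiplier z
      to′ z∈M′ with m , refl ← natural (lookup bounds z∈M′) =
        m , refl , subst (_∈ A) (trans (sym (shift m 0)) (cong (λ y → + suc y) (ℕ.+-identityʳ (m *ℕ d))))
                     (from (rep _) (+ m , + 1 , z∈M′ , (+≤+ (s≤s z≤n) , +≤+ (>-nonZero⁻¹ ks)) , refl))
      from′ : Multiplier z → z ∈ M′
      from′ (m , refl , pm) with to (rep (+ suc (m *ℕ d))) pm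
      ... | z′ , i , z′∈M′ , i∈seg , eq with natural (lookup bounds z′∈M′) | positive i∈seg
      ...   | m′ , refl | r , refl , r<ks =
        subst (_∈ M′) (cong +_ (sym (quotient-unique (ℕ.<-≤-trans r<ks (ℕ.m≤m+n ks kr))
                                       (ℕ.suc-injective (ℤ.+-injective (trans eq (sym (shift m′ r))))))))
              z′∈M′

    M-unique-good : ∀ M′ → GoodM n ks kr A M′ → SameSet M M′
    M-unique-good M′ good z = ⇔-sym (good⇒∈⇔ good z) ⇔-∘ ∈M⇔ z

corollary5 : (α n : ℕ) → 1 ≤ α → 1 ≤ n → (A B : List ℤ) →
    InT α (interval1 n) A B →
    (ks kr : ℕ) → FirstSegmentLength A ks → FirstRiftLength A ks kr →
    Σ (List ℤ) λ M → Unique M × GoodM n ks kr A M ×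
      ((M' : List ℤ) → GoodM n ks kr A M' → SameSet M M')
corollary5 _ n _ 1≤n A B (_ , _ , A+B≡[n] , |[n]|≡ , _ , 0∈B , B≥0) zero _ (_ , 1∉A) _ =
  contradiction (0∈Aℕ 1≤n) 1∉A
  where open Interval n A+B≡[n] |[n]|≡ 0∈B B≥0
corollary5 _ n _ _ A B (_ , _ , A+B≡[n] , |[n]|≡ , _ , 0∈B , B≥0) (suc t′) kr (seg , t∉A) rift =
  M , M-unique , M-good , M-unique-good
  where
  open Interval n A+B≡[n] |[n]|≡ 0∈B B≥0
  open Multipliers (suc t′) kr (block-structure t′ kr seg t∉A rift)
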